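{- Let $p$ be a prime, $\alpha$ a positive integer, and $k\geq 2$ an integer with $k\mid (p-1)$. Let $e$ be an element of order $k$ in the unit group $\mathbb{Z}_{p^\alpha}^{*}$. Then $e^i-1\in\mathbb{Z}_{p^\alpha}^*$ for every $1\leq i<k$, and $1+e+\cdots+e^{k-1}=0$ in $\mathbb{Z}_{p^\alpha}$. Moreover, let $T=\{0,1,1+e,\ldots,1+e+\cdots+e^{k-2}\}=\{(e-1)^{ -1}(e^i-1)\mid i\in\mathbb{Z}_k\}\subseteq\mathbb{Z}_{p^\alpha}$. For $x,y\in\mathbb{Z}_{p^\alpha}$, we have $Tx+y:=\{tx+y\mid t\in T\}=T$ if and only if $x=e^l$ and $y=(e-1)^{ -1}(e^l-1)$ for some $l\in\mathbb{Z}_k$. In particular, $Tx=T$ if and only if $x=1$. -}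

module Defs where

open import Data.Nat as ℕ using (ℕ; zero; suc; NonZero; _<_)
open import Data.Nat.Properties using (m^n≢0)
open import Data.Nat.DivMod using (_mod_)
open import Data.Nat.Primality using (Prime)
open import Data.Fin using (Fin; toℕ)
open import Data.Product using (Σ; ∃; _×_; _,_)
open import Relation.Binary.PropositionalEquality using (_≡_)
open import Function.Bundles using (_⇔_)
open import Relation.Nullary using (¬_)

prime⇒nonZero : ∀ {p} → Prime p → NonZero p
prime⇒nonZero {suc p} _ = _
prime⇒nonZero {zero} ()

primePow-nonZero : ∀ {p} → Prime p → (α : ℕ) → NonZero (p ℕ.^ α)
primePow-nonZero {p} pp α = m^n≢0 p α {{prime⇒nonZero pp}}

module ZMod (N : ℕ) (nz : NonZero N) where

  ℤₙ : Set
  ℤₙ = Fin N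

  [_] : ℕ → ℤₙ
  [ m ] = _mod_ m N {{nz}}

  0# 1# : ℤₙ
  0# = [ 0 ]
  1# = [ 1 ]

  infixl 6 _+_ _-_
  infixl 7 _*_
  infixr 8 _^_

  _+_ : ℤₙ → ℤₙ → ℤₙ
  x + y = [ toℕ x ℕ.+ toℕ y ]

  _*_ : ℤₙ → ℤₙ → ℤₙ
  x * y = [ toℕ x ℕ.* toℕ y ]

  -_ : ℤₙ → ℤₙ
  - x = [ N ℕ.∸ toℕ x ]

  _-_ : ℤₙ → ℤₙ → ℤₙ
  x - y = x + (- y)

  _^_ : ℤₙ → ℕ → ℤₙ
  x ^ zero  = 1#
  x ^ suc n = x * (x ^ n)

  IsUnit : ℤₙ → Set
  IsUnit x = ∃ λ y → x * y ≡ 1#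

  HasOrder : ℤₙ → ℕ → Set
  HasOrder e k = (1 ℕ.≤ k) × (e ^ k ≡ 1#) × (∀ i → 1 ℕ.≤ i → i < k → ¬ (e ^ i ≡ 1#))

  geomSum : ℤₙ → ℕ → ℤₙ
  geomSum e zero    = 0#
  geomSum e (suc i) = geomSum e i + e ^ i

  InT : ℤₙ → ℕ → ℤₙ → Set
  InT e k z = ∃ λ i → i < k × z ≡ geomSum e i

  InAffineT : ℤₙ → ℕ → ℤₙ → ℤₙ → ℤₙ → Set
  InAffineT e k x y z = ∃ λ t → InT e k t × z ≡ t * x + y

  SameSet : (ℤₙ → Set) → (ℤₙ → Set) → Set
  SameSet P Q = ∀ z → P z ⇔ Q z

{-# OPTIONS --safe #-}
-- ℤ/p^α is a local ring: every element is a unit or a multiple of p. If f^k = 1, f ≠ 1 and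
-- p ∣ f − 1, then 1 + f + ⋯ + f^(k−1) ≡ k (mod p) is a unit, because p ∤ k (k divides p − 1);
-- but (f − 1)(1 + f + ⋯ + f^(k−1)) = f^k − 1 = 0 then forces f = 1. Hence e^i − 1 is a unit
-- for 0 < i < k and, with u = (e − 1)⁻¹, the elements of T are G_i = u (e^i − 1).
-- So t ↦ t e^l + G_l sends G_i to G_(i+l mod k), i.e. T e^l + G_l = T.
-- Conversely, if T x + y = T then t ↦ t x + y permutes T, so ΣT = (ΣT) x + k y. The same
-- identity for the rotation (x, y) = (e, 1) gives k = ΣT (1 − e), whence k y = k u (x − 1), and
-- y = u (x − 1) as k is a unit. Since 0 ∈ T also y ∈ T, say y = G_l = u (e^l − 1), so x = e^l.

module Submission where

open import Defs
open import Data.Nat as ℕ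
  using (ℕ; zero; suc; NonZero; _≤_; _<_; _∸_; _%_; z≤n; s≤s) renaming (_^_ to _^ℕ_)
import Data.Nat.Properties as ℕ
open import Data.Nat.DivMod
  using (_/_; m%n<n; m<n⇒m%n≡m; %-distribˡ-+; %-distribˡ-*; n%n≡0; m*n%n≡0; m≡m%n+[m/n]*n)
open import Data.Nat.Divisibility
  using (_∣_; _∣?_; m∣m*n; ∣-trans; ∣1⇒≡1; ∣⇒≤; %-presˡ-∣; ∣n∣m%n⇒∣m; ∣m+n∣m⇒∣n; ∣m⇒∣m*n)
open import Data.Nat.Primality using (Prime; prime⇒irreducible; prime⇒nonTrivial)
open import Data.Nat.Coprimality using (Coprime; coprime-divisor; coprime-Bézout)
open import Data.Nat.GCD using (module Bézout)
open import Data.Integer as ℤ using (ℤ; -[1+_]; _⊖_; _◃_)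
import Data.Integer.Properties as ℤ
import Data.Sign as Sign
open import Data.Fin using (Fin; toℕ; fromℕ<)
open import Data.Fin.Properties using (toℕ-injective; toℕ-fromℕ<; toℕ<n)
open import Data.Fin.Permutation using (permutation)
open import Data.Vec.Functional using (replicate)
open import Data.Maybe using (Maybe; just; nothing)
open import Data.Product using (∃; _×_; _,_; proj₁; proj₂)
open import Data.Sum using (_⊎_; inj₁; inj₂)
open import Function.Bundles using (_⇔_; mk⇔; Equivalence)
open import Relation.Nullary using (¬_; yes; no; contradiction)
open import Relation.Binary.Definitions using (tri<; tri≈; tri>)
open import Relation.Binary.PropositionalEquality
  using (_≡_; _≢_; refl; sym; trans; cong; cong₂; subst; subst₂; isEquivalence; module ≡-Reasoning)
open import Algebra.Bundles using (CommutativeRing)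
open import Algebra.Structures using (IsCommutativeRing)
import Algebra.Solver.Ring.AlmostCommutativeRing as ACR
import Algebra.Properties.Semiring.Sum as SemiringSum

module ZModRing (N : ℕ) (nz : NonZero N) where
  open ZMod N nz
  open ≡-Reasoning

  private instance
    N-nonZero : NonZero N
    N-nonZero = nz

  toℕ-[] : ∀ a → toℕ [ a ] ≡ a % N
  toℕ-[] a = toℕ-fromℕ< _

  []-toℕ : ∀ x → [ toℕ x ] ≡ x
  []-toℕ x = toℕ-injective (trans (toℕ-[] (toℕ x)) (m<n⇒m%n≡m (toℕ<n x)))

  []-cong-% : ∀ {a b} → a % N ≡ b % N → [ a ] ≡ [ b ]
  []-cong-% {a} {b} eq = toℕ-injective (trans (toℕ-[] a) (trans eq (sym (toℕ-[] b))))

  [+] : ∀ a b → [ a ℕ.+ b ] ≡ [ a ] + [ b ]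
  [+] a b = []-cong-% (trans (%-distribˡ-+ a b N) (sym (cong₂ (λ s t → (s ℕ.+ t) % N) (toℕ-[] a) (toℕ-[] b))))

  [*] : ∀ a b → [ a ℕ.* b ] ≡ [ a ] * [ b ]
  [*] a b = []-cong-% (trans (%-distribˡ-* a b N) (sym (cong₂ (λ s t → (s ℕ.* t) % N) (toℕ-[] a) (toℕ-[] b))))

  [N]≡0 : [ N ] ≡ 0#
  [N]≡0 = []-cong-% (trans (n%n≡0 N) (sym (m*n%n≡0 0 N)))

  [m*N]≡0 : ∀ m → [ m ℕ.* N ] ≡ 0#
  [m*N]≡0 m = []-cong-% (trans (m*n%n≡0 m N) (sym (m*n%n≡0 0 N)))

  -- Every ring law is pulled back from ℕ along [_], which preserves + and * by [+] and [*].

  +-assoc : ∀ x y z → (x + y) + z ≡ x + (y + z)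
  +-assoc x y z = begin
    (x + y) + z                            ≡⟨ cong ((x + y) +_) ([]-toℕ z) ⟨
    [ toℕ x ℕ.+ toℕ y ] + [ toℕ z ]        ≡⟨ [+] _ (toℕ z) ⟨
    [ toℕ x ℕ.+ toℕ y ℕ.+ toℕ z ]          ≡⟨ cong [_] (ℕ.+-assoc (toℕ x) (toℕ y) (toℕ z)) ⟩
    [ toℕ x ℕ.+ (toℕ y ℕ.+ toℕ z) ]        ≡⟨ [+] (toℕ x) _ ⟩
    [ toℕ x ] + (y + z)                    ≡⟨ cong (_+ (y + z)) ([]-toℕ x) ⟩
    x + (y + z)                            ∎

  *-assoc : ∀ x y z → (x * y) * z ≡ x * (y * z)
  *-assoc x y z = begin
    (x * y) * z                            ≡⟨ cong ((x * y) *_) ([]-toℕ z) ⟨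
    [ toℕ x ℕ.* toℕ y ] * [ toℕ z ]        ≡⟨ [*] _ (toℕ z) ⟨
    [ toℕ x ℕ.* toℕ y ℕ.* toℕ z ]          ≡⟨ cong [_] (ℕ.*-assoc (toℕ x) (toℕ y) (toℕ z)) ⟩
    [ toℕ x ℕ.* (toℕ y ℕ.* toℕ z) ]        ≡⟨ [*] (toℕ x) _ ⟩
    [ toℕ x ] * (y * z)                    ≡⟨ cong (_* (y * z)) ([]-toℕ x) ⟩
    x * (y * z)                            ∎

  *-distribˡ-+ : ∀ x y z → x * (y + z) ≡ x * y + x * z
  *-distribˡ-+ x y z = begin
    x * (y + z)                                    ≡⟨ cong (_* (y + z)) ([]-toℕ x) ⟨
    [ toℕ x ] * [ toℕ y ℕ.+ toℕ z ]                ≡⟨ [*] (toℕ x) _ ⟨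
    [ toℕ x ℕ.* (toℕ y ℕ.+ toℕ z) ]                ≡⟨ cong [_] (ℕ.*-distribˡ-+ (toℕ x) (toℕ y) (toℕ z)) ⟩
    [ toℕ x ℕ.* toℕ y ℕ.+ toℕ x ℕ.* toℕ z ]        ≡⟨ [+] _ _ ⟩
    x * y + x * z                                  ∎

  +-comm : ∀ x y → x + y ≡ y + x
  +-comm x y = cong [_] (ℕ.+-comm (toℕ x) (toℕ y))

  *-comm : ∀ x y → x * y ≡ y * x
  *-comm x y = cong [_] (ℕ.*-comm (toℕ x) (toℕ y))

  +-identityˡ : ∀ x → 0# + x ≡ x
  +-identityˡ x = trans (cong (0# +_) (sym ([]-toℕ x))) (trans (sym ([+] 0 (toℕ x))) ([]-toℕ x))

  +-identityʳ : ∀ x → x + 0# ≡ x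
  +-identityʳ x = trans (+-comm x 0#) (+-identityˡ x)

  *-identityˡ : ∀ x → 1# * x ≡ x
  *-identityˡ x = begin
    1# * x              ≡⟨ cong (1# *_) ([]-toℕ x) ⟨
    [ 1 ] * [ toℕ x ]   ≡⟨ [*] 1 (toℕ x) ⟨
    [ 1 ℕ.* toℕ x ]     ≡⟨ cong [_] (ℕ.*-identityˡ (toℕ x)) ⟩
    [ toℕ x ]           ≡⟨ []-toℕ x ⟩
    x                   ∎

  *-identityʳ : ∀ x → x * 1# ≡ x
  *-identityʳ x = trans (*-comm x 1#) (*-identityˡ x)

  *-distribʳ-+ : ∀ x y z → (y + z) * x ≡ y * x + z * x
  *-distribʳ-+ x y z = trans (*-comm (y + z) x)
    (trans (*-distribˡ-+ x y z) (cong₂ _+_ (*-comm x y) (*-comm x z)))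

  -‿inverseˡ : ∀ x → (- x) + x ≡ 0#
  -‿inverseˡ x = begin
    - x + x                         ≡⟨ cong (- x +_) ([]-toℕ x) ⟨
    [ N ∸ toℕ x ] + [ toℕ x ]       ≡⟨ [+] (N ∸ toℕ x) _ ⟨
    [ N ∸ toℕ x ℕ.+ toℕ x ]         ≡⟨ cong [_] (ℕ.m∸n+n≡m (ℕ.<⇒≤ (toℕ<n x))) ⟩
    [ N ]                           ≡⟨ [N]≡0 ⟩
    0#                              ∎

  -‿inverseʳ : ∀ x → x + (- x) ≡ 0#
  -‿inverseʳ x = trans (+-comm x (- x)) (-‿inverseˡ x)

  isCommutativeRing : IsCommutativeRing _≡_ _+_ _*_ -_ 0# 1#
  isCommutativeRing = record
    { isRing = record
      { +-isAbelianGroup = record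
        { isGroup = record
          { isMonoid = record
            { isSemigroup = record
              { isMagma = record { isEquivalence = isEquivalence ; ∙-cong = cong₂ _+_ }
              ; assoc = +-assoc
              }
            ; identity = +-identityˡ , +-identityʳ
            }
          ; inverse = -‿inverseˡ , -‿inverseʳ
          ; ⁻¹-cong = cong (-_)
          }
        ; comm = +-comm
        }
      ; *-cong = cong₂ _*_
      ; *-assoc = *-assoc
      ; *-identity = *-identityˡ , *-identityʳ
      ; distrib = *-distribˡ-+ , *-distribʳ-+
      }
    ; *-comm = *-comm
    }

  commutativeRing : CommutativeRing _ _
  commutativeRing = record { isCommutativeRing = isCommutativeRing }

  open import Algebra.Properties.AbelianGroup (CommutativeRing.+-abelianGroup commutativeRing) public
    using (ε⁻¹≈ε; ⁻¹-involutive; inverseʳ-unique; ⁻¹-∙-comm; ⁻¹-anti-homo‿-; //-rightDividesʳ; ∙-cancelʳ; x∙y⁻¹≈ε⇒x≈y)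
  open import Algebra.Properties.Ring (CommutativeRing.ring commutativeRing) public
    using (-‿distribˡ-*; -‿distribʳ-*)
  open CommutativeRing commutativeRing public using (zeroˡ; zeroʳ)

  fromℤ : ℤ → ℤₙ
  fromℤ (ℤ.+ n)  = [ n ]
  fromℤ -[1+ n ] = - [ suc n ]

  fromℤ-+◃ : ∀ n → fromℤ (Sign.+ ◃ n) ≡ [ n ]
  fromℤ-+◃ zero    = refl
  fromℤ-+◃ (suc n) = refl

  fromℤ--◃ : ∀ n → fromℤ (Sign.- ◃ n) ≡ - [ n ]
  fromℤ--◃ zero    = sym ε⁻¹≈ε
  fromℤ--◃ (suc n) = refl

  fromℤ-‿ : ∀ i → fromℤ (ℤ.- i) ≡ - fromℤ i
  fromℤ-‿ (ℤ.+ zero)    = sym ε⁻¹≈ε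
  fromℤ-‿ (ℤ.+ (suc n)) = refl
  fromℤ-‿ -[1+ n ]      = sym (⁻¹-involutive _)

  [∸] : ∀ {m n} → n ≤ m → [ m ∸ n ] ≡ [ m ] - [ n ]
  [∸] {m} {n} n≤m = begin
    [ m ∸ n ]                      ≡⟨ //-rightDividesʳ [ n ] [ m ∸ n ] ⟨
    [ m ∸ n ] + [ n ] - [ n ]      ≡⟨ cong (_- [ n ]) ([+] (m ∸ n) n) ⟨
    [ m ∸ n ℕ.+ n ] - [ n ]        ≡⟨ cong (λ t → [ t ] - [ n ]) (ℕ.m∸n+n≡m n≤m) ⟩
    [ m ] - [ n ]                  ∎

  fromℤ-⊖ : ∀ m n → fromℤ (m ⊖ n) ≡ [ m ] - [ n ]
  fromℤ-⊖ m n with n ℕ.≤? m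
  ... | yes n≤m = trans (cong fromℤ (ℤ.⊖-≥ n≤m)) ([∸] n≤m)
  ... | no n≰m = begin
    fromℤ (m ⊖ n)              ≡⟨ cong fromℤ (ℤ.⊖-≰ n≰m) ⟩
    fromℤ (ℤ.- ℤ.+ (n ∸ m))    ≡⟨ fromℤ-‿ (ℤ.+ (n ∸ m)) ⟩
    - [ n ∸ m ]                ≡⟨ cong (-_) ([∸] (ℕ.≰⇒≥ n≰m)) ⟩
    - ([ n ] - [ m ])          ≡⟨ ⁻¹-anti-homo‿- [ n ] [ m ] ⟩
    [ m ] - [ n ]              ∎

  fromℤ-+ : ∀ i j → fromℤ (i ℤ.+ j) ≡ fromℤ i + fromℤ j
  fromℤ-+ (ℤ.+ m)  (ℤ.+ n)  = [+] m n
  fromℤ-+ (ℤ.+ m)  -[1+ n ] = fromℤ-⊖ m (suc n)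
  fromℤ-+ -[1+ m ] (ℤ.+ n)  = trans (fromℤ-⊖ n (suc m)) (+-comm [ n ] _)
  fromℤ-+ -[1+ m ] -[1+ n ] = begin
    - [ suc (suc (m ℕ.+ n)) ]      ≡⟨ cong (λ t → - [ t ]) (ℕ.+-suc (suc m) n) ⟨
    - [ suc m ℕ.+ suc n ]          ≡⟨ cong (-_) ([+] (suc m) (suc n)) ⟩
    - ([ suc m ] + [ suc n ])      ≡⟨ ⁻¹-∙-comm [ suc m ] [ suc n ] ⟨
    - [ suc m ] + - [ suc n ]      ∎

  fromℤ-* : ∀ i j → fromℤ (i ℤ.* j) ≡ fromℤ i * fromℤ j
  fromℤ-* (ℤ.+ m)  (ℤ.+ n)  = trans (fromℤ-+◃ (m ℕ.* n)) ([*] m n)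
  fromℤ-* (ℤ.+ m)  -[1+ n ] = begin
    fromℤ (Sign.- ◃ (m ℕ.* suc n))  ≡⟨ fromℤ--◃ _ ⟩
    - [ m ℕ.* suc n ]               ≡⟨ cong (-_) ([*] m (suc n)) ⟩
    - ([ m ] * [ suc n ])           ≡⟨ -‿distribʳ-* [ m ] [ suc n ] ⟩
    [ m ] * - [ suc n ]             ∎
  fromℤ-* -[1+ m ] (ℤ.+ n)  = begin
    fromℤ (Sign.- ◃ (suc m ℕ.* n))  ≡⟨ fromℤ--◃ _ ⟩
    - [ suc m ℕ.* n ]               ≡⟨ cong (-_) ([*] (suc m) n) ⟩
    - ([ suc m ] * [ n ])           ≡⟨ -‿distribˡ-* [ suc m ] [ n ] ⟩
    - [ suc m ] * [ n ]             ∎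
  fromℤ-* -[1+ m ] -[1+ n ] = begin
    fromℤ (Sign.+ ◃ (suc m ℕ.* suc n))  ≡⟨ fromℤ-+◃ _ ⟩
    [ suc m ℕ.* suc n ]                 ≡⟨ [*] (suc m) (suc n) ⟩
    [ suc m ] * [ suc n ]               ≡⟨ ⁻¹-involutive ([ suc m ] * [ suc n ]) ⟨
    - - ([ suc m ] * [ suc n ])         ≡⟨ cong (-_) (-‿distribˡ-* [ suc m ] [ suc n ]) ⟩
    - (- [ suc m ] * [ suc n ])         ≡⟨ -‿distribʳ-* (- [ suc m ]) [ suc n ] ⟩
    - [ suc m ] * - [ suc n ]           ∎

  fromℤ-morphism : CommutativeRing.rawRing ℤ.+-*-commutativeRing
                     ACR.-Raw-AlmostCommutative⟶ ACR.fromCommutativeRing commutativeRing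
  fromℤ-morphism = record
    { ⟦_⟧ = fromℤ ; +-homo = fromℤ-+ ; *-homo = fromℤ-* ; -‿homo = fromℤ-‿ ; 0-homo = refl ; 1-homo = refl }

  fromℤ-≟ : ∀ i j → Maybe (fromℤ i ≡ fromℤ j)
  fromℤ-≟ i j with i ℤ.≟ j
  ... | yes i≡j = just (cong fromℤ i≡j)
  ... | no _    = nothing

  open import Algebra.Solver.Ring (CommutativeRing.rawRing ℤ.+-*-commutativeRing)
    (ACR.fromCommutativeRing commutativeRing) fromℤ-morphism fromℤ-≟ public
    using (solve; _:=_; _:+_; _:*_; _:-_; :-_; con; Polynomial)

  :0 :1 : ∀ {n} → Polynomial n
  :0 = con (ℤ.+ 0)
  :1 = con (ℤ.+ 1)

module ZModProperties (N : ℕ) (nz : NonZero N) where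
  open ZMod N nz
  open ZModRing N nz public
  open ≡-Reasoning

  isUnit-*-cancelˡ : ∀ x {a b} → IsUnit x → x * a ≡ x * b → a ≡ b
  isUnit-*-cancelˡ x {a} {b} (w , xw≡1) xa≡xb = begin
    a              ≡⟨ *-identityˡ a ⟨
    1# * a         ≡⟨ cong (_* a) xw≡1 ⟨
    x * w * a      ≡⟨ reorder a ⟩
    w * (x * a)    ≡⟨ cong (w *_) xa≡xb ⟩
    w * (x * b)    ≡⟨ reorder b ⟨
    x * w * b      ≡⟨ cong (_* b) xw≡1 ⟩
    1# * b         ≡⟨ *-identityˡ b ⟩
    b              ∎
    where
    reorder : ∀ c → x * w * c ≡ w * (x * c)
    reorder = solve 3 (λ x w c → x :* w :* c := w :* (x :* c)) refl x w

  isUnit-*-cancelʳ : ∀ x {a b} → IsUnit x → a * x ≡ b * x → a ≡ b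
  isUnit-*-cancelʳ x {a} {b} x-unit ax≡bx =
    isUnit-*-cancelˡ x x-unit (trans (*-comm x a) (trans ax≡bx (*-comm b x)))

  -1#-injective : ∀ {a b} → a - 1# ≡ b - 1# → a ≡ b
  -1#-injective {a} {b} = ∙-cancelʳ (- 1#) a b

  ^-+ : ∀ x m n → x ^ (m ℕ.+ n) ≡ x ^ m * x ^ n
  ^-+ x zero    n = sym (*-identityˡ (x ^ n))
  ^-+ x (suc m) n = trans (cong (x *_) (^-+ x m n)) (sym (*-assoc x (x ^ m) (x ^ n)))

  ^-* : ∀ x m n → x ^ (m ℕ.* n) ≡ (x ^ m) ^ n
  ^-* x m zero    = cong (x ^_) (ℕ.*-zeroʳ m)
  ^-* x m (suc n) = begin
    x ^ (m ℕ.* suc n)        ≡⟨ cong (x ^_) (ℕ.*-suc m n) ⟩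
    x ^ (m ℕ.+ m ℕ.* n)      ≡⟨ ^-+ x m (m ℕ.* n) ⟩
    x ^ m * x ^ (m ℕ.* n)    ≡⟨ cong (x ^ m *_) (^-* x m n) ⟩
    x ^ m * (x ^ m) ^ n      ∎

  1^n≡1 : ∀ n → 1# ^ n ≡ 1#
  1^n≡1 zero    = refl
  1^n≡1 (suc n) = trans (cong (1# *_) (1^n≡1 n)) (*-identityˡ 1#)

  ^-comm : ∀ x m n → (x ^ m) ^ n ≡ (x ^ n) ^ m
  ^-comm x m n = trans (sym (^-* x m n)) (trans (cong (x ^_) (ℕ.*-comm m n)) (^-* x n m))

  ^-isUnit : ∀ {x} → IsUnit x → ∀ n → IsUnit (x ^ n)
  ^-isUnit {x} (w , xw≡1) n = w ^ n , go n
    where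
    go : ∀ n → x ^ n * w ^ n ≡ 1#
    go zero    = *-identityˡ 1#
    go (suc n) = begin
      x * x ^ n * (w * w ^ n)      ≡⟨ solve 4 (λ x w a b → x :* a :* (w :* b) := x :* w :* (a :* b)) refl x w (x ^ n) (w ^ n) ⟩
      x * w * (x ^ n * w ^ n)      ≡⟨ cong₂ _*_ xw≡1 (go n) ⟩
      1# * 1#                      ≡⟨ *-identityˡ 1# ⟩
      1#                           ∎

  ^-%-period : ∀ {x k} .{{_ : NonZero k}} → x ^ k ≡ 1# → ∀ a → x ^ a ≡ x ^ (a % k)
  ^-%-period {x} {k} xᵏ≡1 a = begin
    x ^ a                                  ≡⟨ cong (x ^_) (m≡m%n+[m/n]*n a k) ⟩
    x ^ (a % k ℕ.+ a / k ℕ.* k)            ≡⟨ ^-+ x (a % k) _ ⟩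
    x ^ (a % k) * x ^ (a / k ℕ.* k)        ≡⟨ cong (λ t → x ^ (a % k) * x ^ t) (ℕ.*-comm (a / k) k) ⟩
    x ^ (a % k) * x ^ (k ℕ.* (a / k))      ≡⟨ cong (x ^ (a % k) *_) (^-* x k (a / k)) ⟩
    x ^ (a % k) * (x ^ k) ^ (a / k)        ≡⟨ cong (λ t → x ^ (a % k) * t ^ (a / k)) xᵏ≡1 ⟩
    x ^ (a % k) * 1# ^ (a / k)             ≡⟨ cong (x ^ (a % k) *_) (1^n≡1 (a / k)) ⟩
    x ^ (a % k) * 1#                       ≡⟨ *-identityʳ _ ⟩
    x ^ (a % k)                            ∎

  [f-1]*geomSum : ∀ f n → (f - 1#) * geomSum f n ≡ f ^ n - 1#
  [f-1]*geomSum f zero    = solve 1 (λ f → (f :- :1) :* :0 := :1 :- :1) refl f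
  [f-1]*geomSum f (suc n) = begin
    (f - 1#) * (geomSum f n + f ^ n)                 ≡⟨ *-distribˡ-+ (f - 1#) _ _ ⟩
    (f - 1#) * geomSum f n + (f - 1#) * f ^ n        ≡⟨ cong (_+ (f - 1#) * f ^ n) ([f-1]*geomSum f n) ⟩
    (f ^ n - 1#) + (f - 1#) * f ^ n                  ≡⟨ solve 2 (λ f fⁿ → fⁿ :- :1 :+ (f :- :1) :* fⁿ := f :* fⁿ :- :1) refl f (f ^ n) ⟩
    f * f ^ n - 1#                                   ∎

  geomSum≡u*[fⁿ-1] : ∀ {f u} → (f - 1#) * u ≡ 1# → ∀ n → geomSum f n ≡ u * (f ^ n - 1#)
  geomSum≡u*[fⁿ-1] {f} {u} [f-1]u≡1 n = begin
    geomSum f n                      ≡⟨ *-identityˡ (geomSum f n) ⟨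
    1# * geomSum f n                 ≡⟨ cong (_* geomSum f n) [f-1]u≡1 ⟨
    (f - 1#) * u * geomSum f n       ≡⟨ solve 3 (λ a u g → a :* u :* g := u :* (a :* g)) refl (f - 1#) u (geomSum f n) ⟩
    u * ((f - 1#) * geomSum f n)     ≡⟨ cong (u *_) ([f-1]*geomSum f n) ⟩
    u * (f ^ n - 1#)                 ∎

  geomSum-root-of-unity : ∀ {f k} → IsUnit (f - 1#) → f ^ k ≡ 1# → geomSum f k ≡ 0#
  geomSum-root-of-unity {f} {k} (u , [f-1]u≡1) fᵏ≡1 = begin
    geomSum f k         ≡⟨ geomSum≡u*[fⁿ-1] [f-1]u≡1 k ⟩
    u * (f ^ k - 1#)    ≡⟨ cong (λ t → u * (t - 1#)) fᵏ≡1 ⟩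
    u * (1# - 1#)       ≡⟨ cong (u *_) (-‿inverseʳ 1#) ⟩
    u * 0#              ≡⟨ zeroʳ u ⟩
    0#                  ∎

  geomSum≡n+[f-1]*q : ∀ f n → ∃ λ q → geomSum f n ≡ [ n ] + (f - 1#) * q
  geomSum≡n+[f-1]*q f zero    = 0# , solve 1 (λ f → :0 := :0 :+ (f :- :1) :* :0) refl f
  geomSum≡n+[f-1]*q f (suc n) with geomSum≡n+[f-1]*q f n
  ... | q , eq = q + geomSum f n , (begin
    geomSum f n + f ^ n                                        ≡⟨ cong₂ _+_ eq fⁿ≡1+[f-1]*geomSum ⟩
    ([ n ] + (f - 1#) * q) + (1# + (f - 1#) * geomSum f n)     ≡⟨ solve 4 (λ n f q g → n :+ (f :- :1) :* q :+ (:1 :+ (f :- :1) :* g) := :1 :+ n :+ (f :- :1) :* (q :+ g)) refl [ n ] f q (geomSum f n) ⟩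
    1# + [ n ] + (f - 1#) * (q + geomSum f n)                  ≡⟨ cong (_+ (f - 1#) * (q + geomSum f n)) ([+] 1 n) ⟨
    [ suc n ] + (f - 1#) * (q + geomSum f n)                   ∎)
    where
    fⁿ≡1+[f-1]*geomSum : f ^ n ≡ 1# + (f - 1#) * geomSum f n
    fⁿ≡1+[f-1]*geomSum = trans (solve 1 (λ a → a := :1 :+ (a :- :1)) refl (f ^ n))
                               (cong (1# +_) (sym ([f-1]*geomSum f n)))

  open SemiringSum (CommutativeRing.semiring commutativeRing) public
    using (sum; sum-permute; sum-cong-≗)
  open SemiringSum (CommutativeRing.semiring commutativeRing)
    using (∑-distrib-+; *-distribʳ-sum; sum-replicate)
  open import Algebra.Properties.Monoid.Mult (CommutativeRing.+-monoid commutativeRing) using () renaming (_×_ to _·_)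

  ×≡[]* : ∀ n y → n · y ≡ [ n ] * y
  ×≡[]* zero    y = sym (zeroˡ y)
  ×≡[]* (suc n) y = begin
    y + n · y                ≡⟨ cong₂ _+_ (sym (*-identityˡ y)) (×≡[]* n y) ⟩
    1# * y + [ n ] * y       ≡⟨ *-distribʳ-+ y 1# [ n ] ⟨
    (1# + [ n ]) * y         ≡⟨ cong (_* y) ([+] 1 n) ⟨
    [ suc n ] * y            ∎

  ∑-affine : ∀ {n} (g : Fin n → ℤₙ) x y → sum (λ i → g i * x + y) ≡ sum g * x + [ n ] * y
  ∑-affine {n} g x y = begin
    sum (λ i → g i * x + y)                    ≡⟨ ∑-distrib-+ (λ i → g i * x) (replicate n y) ⟩
    sum (λ i → g i * x) + sum (replicate n y)  ≡⟨ cong₂ _+_ (sym (*-distribʳ-sum x g)) (sum-replicate n) ⟩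
    sum g * x + n · y                          ≡⟨ cong (sum g * x +_) (×≡[]* n y) ⟩
    sum g * x + [ n ] * y                      ∎

∣m∸1⇒m∤ : ∀ {m k} → 2 ≤ m → 1 ≤ k → k ∣ m ∸ 1 → ¬ m ∣ k
∣m∸1⇒m∤ {suc (suc _)} {suc _} (s≤s (s≤s z≤n)) _ k∣m-1 m∣k = ℕ.<⇒≱ (ℕ.s≤s (∣⇒≤ k∣m-1)) (∣⇒≤ m∣k)

m∣m^n : ∀ {m n} → 1 ≤ n → m ∣ m ^ℕ n
m∣m^n {m} {suc n} _ = m∣m*n (m ^ℕ n)

coprime-* : ∀ {a m n} → Coprime a m → Coprime a n → Coprime a (m ℕ.* n)
coprime-* {a} {m} {n} a⊥m a⊥n (i∣a , i∣mn) = a⊥n (i∣a , coprime-divisor i⊥m i∣mn)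
  where
  i⊥m : Coprime _ m
  i⊥m (j∣i , j∣m) = a⊥m (∣-trans j∣i i∣a , j∣m)

coprime-^ : ∀ {a m} → Coprime a m → ∀ n → Coprime a (m ^ℕ n)
coprime-^ a⊥m zero    (_ , i∣1) = ∣1⇒≡1 i∣1
coprime-^ a⊥m (suc n) = coprime-* a⊥m (coprime-^ a⊥m n)

∤⇒coprime : ∀ {p a} → Prime p → ¬ p ∣ a → Coprime a p
∤⇒coprime pp p∤a (i∣a , i∣p) with prime⇒irreducible pp i∣p
... | inj₁ i≡1 = i≡1
... | inj₂ refl = contradiction i∣a p∤a

module ZModPrimePower (p α : ℕ) (pp : Prime p) (1≤α : 1 ≤ α) where
  N : ℕ
  N = p ^ℕ α

  nz : NonZero N
  nz = primePow-nonZero pp α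

  open ZMod N nz
  open ZModProperties N nz
  open ≡-Reasoning

  private instance
    N-nonZero : NonZero N
    N-nonZero = nz

  p∣N : p ∣ N
  p∣N = m∣m^n 1≤α

  MultipleOfP : ℤₙ → Set
  MultipleOfP x = p ∣ toℕ x

  multipleOfP[]⇒∣ : ∀ {a} → MultipleOfP [ a ] → p ∣ a
  multipleOfP[]⇒∣ {a} p∣[a] = ∣n∣m%n⇒∣m p∣N (subst (p ∣_) (toℕ-[] a) p∣[a])

  multipleOfP-*ʳ : ∀ {x} y → MultipleOfP x → MultipleOfP (x * y)
  multipleOfP-*ʳ {x} y p∣x = subst (p ∣_) (sym (toℕ-[] _)) (%-presˡ-∣ (∣m⇒∣m*n (toℕ y) p∣x) p∣N)

  multipleOfP-+⇒ˡ : ∀ {x y} → MultipleOfP (x + y) → MultipleOfP y → MultipleOfP x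
  multipleOfP-+⇒ˡ {x} {y} p∣x+y p∣y =
    ∣m+n∣m⇒∣n (subst (p ∣_) (ℕ.+-comm (toℕ x) (toℕ y)) (multipleOfP[]⇒∣ p∣x+y)) p∣y

  ∤⇒isUnit : ∀ {a} → ¬ p ∣ a → IsUnit [ a ]
  ∤⇒isUnit {a} p∤a with coprime-Bézout (coprime-^ (∤⇒coprime pp p∤a) α)
  ... | Bézout.+- x y 1+yN≡xa = [ x ] , (begin
    [ a ] * [ x ]          ≡⟨ *-comm [ a ] [ x ] ⟩
    [ x ] * [ a ]          ≡⟨ [*] x a ⟨
    [ x ℕ.* a ]            ≡⟨ cong [_] 1+yN≡xa ⟨
    [ 1 ℕ.+ y ℕ.* N ]      ≡⟨ [+] 1 (y ℕ.* N) ⟩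
    1# + [ y ℕ.* N ]       ≡⟨ cong (1# +_) ([m*N]≡0 y) ⟩
    1# + 0#                ≡⟨ +-identityʳ 1# ⟩
    1#                     ∎)
  ... | Bézout.-+ x y 1+xa≡yN = - [ x ] , (begin
    [ a ] * - [ x ]        ≡⟨ -‿distribʳ-* [ a ] [ x ] ⟨
    - ([ a ] * [ x ])      ≡⟨ cong (-_) (trans (*-comm [ a ] [ x ]) (sym ([*] x a))) ⟩
    - [ x ℕ.* a ]          ≡⟨ cong (-_) [xa]≡-1 ⟩
    - - 1#                 ≡⟨ ⁻¹-involutive 1# ⟩
    1#                     ∎)
    where
    [xa]≡-1 : [ x ℕ.* a ] ≡ - 1#
    [xa]≡-1 = inverseʳ-unique 1# _ (trans (sym ([+] 1 (x ℕ.* a))) (trans (cong [_] 1+xa≡yN) ([m*N]≡0 y)))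

  isUnit⊎multipleOfP : ∀ x → IsUnit x ⊎ MultipleOfP x
  isUnit⊎multipleOfP x with p ∣? toℕ x
  ... | yes p∣x = inj₂ p∣x
  ... | no  p∤x = inj₁ (subst IsUnit ([]-toℕ x) (∤⇒isUnit p∤x))

  geomSum-isUnit : ∀ {f n} → ¬ p ∣ n → MultipleOfP (f - 1#) → IsUnit (geomSum f n)
  geomSum-isUnit {f} {n} p∤n p∣f-1 with isUnit⊎multipleOfP (geomSum f n) | geomSum≡n+[f-1]*q f n
  ... | inj₁ unit  | _      = unit
  ... | inj₂ p∣sum | q , eq = contradiction (multipleOfP[]⇒∣ p∣[n]) p∤n
    where
    p∣[n] : MultipleOfP [ n ]
    p∣[n] = multipleOfP-+⇒ˡ (subst MultipleOfP eq p∣sum) (multipleOfP-*ʳ q p∣f-1)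

  rootOfUnity-1-isUnit : ∀ {f k} → ¬ p ∣ k → f ^ k ≡ 1# → f ≢ 1# → IsUnit (f - 1#)
  rootOfUnity-1-isUnit {f} {k} p∤k fᵏ≡1 f≢1 with isUnit⊎multipleOfP (f - 1#)
  ... | inj₁ unit  = unit
  ... | inj₂ p∣f-1 = contradiction (x∙y⁻¹≈ε⇒x≈y f 1# f-1≡0) f≢1
    where
    f-1≡0 : f - 1# ≡ 0#
    f-1≡0 = isUnit-*-cancelˡ (geomSum f k) (geomSum-isUnit p∤k p∣f-1) (begin
      geomSum f k * (f - 1#)     ≡⟨ *-comm (geomSum f k) (f - 1#) ⟩
      (f - 1#) * geomSum f k     ≡⟨ [f-1]*geomSum f k ⟩
      f ^ k - 1#                 ≡⟨ cong (_- 1#) fᵏ≡1 ⟩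
      1# - 1#                    ≡⟨ -‿inverseʳ 1# ⟩
      0#                         ≡⟨ zeroʳ (geomSum f k) ⟨
      geomSum f k * 0#           ∎)

module OrderK (p α k : ℕ) (pp : Prime p) (1≤α : 1 ≤ α) (2≤k : 2 ≤ k) (k∣p-1 : k ∣ p ∸ 1)
  (e : Fin (p ^ℕ α))
  (e-unit : ZMod.IsUnit (p ^ℕ α) (primePow-nonZero pp α) e)
  (e-order : ZMod.HasOrder (p ^ℕ α) (primePow-nonZero pp α) e k) where

  open ZModPrimePower p α pp 1≤α
  open ZMod N nz
  open ZModProperties N nz
  open ≡-Reasoning

  0<k : 0 < k
  0<k = ℕ.<-trans ℕ.z<s 2≤k

  private instance
    k-nonZero : NonZero k
    k-nonZero = ℕ.>-nonZero 0<k

  eᵏ≡1 : e ^ k ≡ 1#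
  eᵏ≡1 = proj₁ (proj₂ e-order)

  eⁱ≢1 : ∀ i → 1 ≤ i → i < k → e ^ i ≢ 1#
  eⁱ≢1 = proj₂ (proj₂ e-order)

  p∤k : ¬ p ∣ k
  p∤k = ∣m∸1⇒m∤ (ℕ.nonTrivial⇒n>1 p {{prime⇒nonTrivial pp}}) (ℕ.<⇒≤ 2≤k) k∣p-1

  eⁱ-1-isUnit : ∀ i → 1 ≤ i → i < k → IsUnit (e ^ i - 1#)
  eⁱ-1-isUnit i 1≤i i<k = rootOfUnity-1-isUnit p∤k eⁱᵏ≡1 (eⁱ≢1 i 1≤i i<k)
    where
    eⁱᵏ≡1 : (e ^ i) ^ k ≡ 1#
    eⁱᵏ≡1 = trans (^-comm e i k) (trans (cong (_^ i) eᵏ≡1) (1^n≡1 i))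

  e-1-isUnit : IsUnit (e - 1#)
  e-1-isUnit = subst (λ f → IsUnit (f - 1#)) (*-identityʳ e) (eⁱ-1-isUnit 1 ℕ.≤-refl 2≤k)

  u : ℤₙ
  u = proj₁ e-1-isUnit

  [e-1]u≡1 : (e - 1#) * u ≡ 1#
  [e-1]u≡1 = proj₂ e-1-isUnit

  u-isUnit : IsUnit u
  u-isUnit = e - 1# , trans (*-comm u (e - 1#)) [e-1]u≡1

  G≡u[eⁱ-1] : ∀ i → geomSum e i ≡ u * (e ^ i - 1#)
  G≡u[eⁱ-1] = geomSum≡u*[fⁿ-1] [e-1]u≡1

  eⁱ≢eʲ : ∀ {i j} → i < j → j < k → e ^ i ≢ e ^ j
  eⁱ≢eʲ {i} {j} i<j j<k eⁱ≡eʲ =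
    eⁱ≢1 (j ∸ i) (ℕ.m<n⇒0<n∸m i<j) (ℕ.≤-<-trans (ℕ.m∸n≤m j i) j<k) eʲ⁻ⁱ≡1
    where
    eʲ⁻ⁱ≡1 : e ^ (j ∸ i) ≡ 1#
    eʲ⁻ⁱ≡1 = isUnit-*-cancelˡ (e ^ i) (^-isUnit e-unit i) (begin
      e ^ i * e ^ (j ∸ i)      ≡⟨ ^-+ e i (j ∸ i) ⟨
      e ^ (i ℕ.+ (j ∸ i))      ≡⟨ cong (e ^_) (ℕ.m+[n∸m]≡n (ℕ.<⇒≤ i<j)) ⟩
      e ^ j                    ≡⟨ eⁱ≡eʲ ⟨
      e ^ i                    ≡⟨ *-identityʳ (e ^ i) ⟨
      e ^ i * 1#               ∎)

  ^-injective : ∀ {i j} → i < k → j < k → e ^ i ≡ e ^ j → i ≡ j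
  ^-injective {i} {j} i<k j<k eⁱ≡eʲ with ℕ.<-cmp i j
  ... | tri< i<j _ _ = contradiction eⁱ≡eʲ (eⁱ≢eʲ i<j j<k)
  ... | tri≈ _ i≡j _ = i≡j
  ... | tri> _ _ j<i = contradiction (sym eⁱ≡eʲ) (eⁱ≢eʲ j<i i<k)

  Gᶠ : Fin k → ℤₙ
  Gᶠ i = geomSum e (toℕ i)

  Gᶠ-injective : ∀ {i j} → Gᶠ i ≡ Gᶠ j → i ≡ j
  Gᶠ-injective {i} {j} Gᵢ≡Gⱼ = toℕ-injective (^-injective (toℕ<n i) (toℕ<n j) (-1#-injective (begin
    e ^ toℕ i - 1#           ≡⟨ [f-1]*geomSum e (toℕ i) ⟨
    (e - 1#) * Gᶠ i          ≡⟨ cong ((e - 1#) *_) Gᵢ≡Gⱼ ⟩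
    (e - 1#) * Gᶠ j          ≡⟨ [f-1]*geomSum e (toℕ j) ⟩
    e ^ toℕ j - 1#           ∎)))

  Gᶠ∈T : ∀ i → InT e k (Gᶠ i)
  Gᶠ∈T i = toℕ i , toℕ<n i , refl

  index : ∀ {z} → InT e k z → Fin k
  index (_ , i<k , _) = fromℕ< i<k

  index-spec : ∀ {z} (z∈T : InT e k z) → Gᶠ (index z∈T) ≡ z
  index-spec (i , i<k , z≡Gᵢ) = trans (cong (geomSum e) (toℕ-fromℕ< i<k)) (sym z≡Gᵢ)

  Gᵢeˡ+Gₗ≡u[eⁱ⁺ˡ-1] : ∀ i l → geomSum e i * e ^ l + geomSum e l ≡ u * (e ^ (i ℕ.+ l) - 1#)
  Gᵢeˡ+Gₗ≡u[eⁱ⁺ˡ-1] i l = begin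
    geomSum e i * e ^ l + geomSum e l              ≡⟨ cong₂ (λ s t → s * e ^ l + t) (G≡u[eⁱ-1] i) (G≡u[eⁱ-1] l) ⟩
    u * (e ^ i - 1#) * e ^ l + u * (e ^ l - 1#)    ≡⟨ solve 3 (λ u a b → u :* (a :- :1) :* b :+ u :* (b :- :1) := u :* (a :* b :- :1)) refl u (e ^ i) (e ^ l) ⟩
    u * (e ^ i * e ^ l - 1#)                       ≡⟨ cong (λ t → u * (t - 1#)) (^-+ e i l) ⟨
    u * (e ^ (i ℕ.+ l) - 1#)                       ∎

  rotation-invariant : ∀ l → l < k → SameSet (InAffineT e k (e ^ l) (geomSum e l)) (InT e k)
  rotation-invariant l l<k z = mk⇔ to from
    where
    to : InAffineT e k (e ^ l) (geomSum e l) z → InT e k z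
    to (t , (i , _ , t≡Gᵢ) , z≡teˡ+Gₗ) = (i ℕ.+ l) % k , m%n<n (i ℕ.+ l) k , (begin
      z                                      ≡⟨ z≡teˡ+Gₗ ⟩
      t * e ^ l + geomSum e l                ≡⟨ cong (λ s → s * e ^ l + geomSum e l) t≡Gᵢ ⟩
      geomSum e i * e ^ l + geomSum e l      ≡⟨ Gᵢeˡ+Gₗ≡u[eⁱ⁺ˡ-1] i l ⟩
      u * (e ^ (i ℕ.+ l) - 1#)               ≡⟨ cong (λ s → u * (s - 1#)) (^-%-period eᵏ≡1 (i ℕ.+ l)) ⟩
      u * (e ^ ((i ℕ.+ l) % k) - 1#)         ≡⟨ G≡u[eⁱ-1] ((i ℕ.+ l) % k) ⟨
      geomSum e ((i ℕ.+ l) % k)              ∎)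
    from : InT e k z → InAffineT e k (e ^ l) (geomSum e l) z
    from (j , _ , z≡Gⱼ) = geomSum e i , (i , m%n<n a k , refl) , (begin
      z                                      ≡⟨ z≡Gⱼ ⟩
      geomSum e j                            ≡⟨ G≡u[eⁱ-1] j ⟩
      u * (e ^ j - 1#)                       ≡⟨ cong (λ s → u * (s - 1#)) eⁱ⁺ˡ≡eʲ ⟨
      u * (e ^ (i ℕ.+ l) - 1#)               ≡⟨ Gᵢeˡ+Gₗ≡u[eⁱ⁺ˡ-1] i l ⟨
      geomSum e i * e ^ l + geomSum e l      ∎)
      where
      -- i = j − l mod k, written so that no truncated subtraction occurs
      a i : ℕ
      a = j ℕ.+ (k ∸ l)
      i = a % k
      eⁱ⁺ˡ≡eʲ : e ^ (i ℕ.+ l) ≡ e ^ j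
      eⁱ⁺ˡ≡eʲ = begin
        e ^ (i ℕ.+ l)            ≡⟨ ^-+ e i l ⟩
        e ^ i * e ^ l            ≡⟨ cong (_* e ^ l) (^-%-period eᵏ≡1 a) ⟨
        e ^ a * e ^ l            ≡⟨ ^-+ e a l ⟨
        e ^ (a ℕ.+ l)            ≡⟨ cong (e ^_) (trans (ℕ.+-assoc j (k ∸ l) l) (cong (j ℕ.+_) (ℕ.m∸n+n≡m (ℕ.<⇒≤ l<k)))) ⟩
        e ^ (j ℕ.+ k)            ≡⟨ ^-+ e j k ⟩
        e ^ j * e ^ k            ≡⟨ cong (e ^ j *_) eᵏ≡1 ⟩
        e ^ j * 1#               ≡⟨ *-identityʳ (e ^ j) ⟩
        e ^ j                    ∎

  affine-invariant⇒isUnit : ∀ {x y} → SameSet (InAffineT e k x y) (InT e k) → IsUnit x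
  affine-invariant⇒isUnit {x} {y} invariant
    with Equivalence.from (invariant 0#) (0 , 0<k , refl)
       | Equivalence.from (invariant (0# + 1#)) (1 , 2≤k , refl)
  ... | t₀ , _ , 0≡t₀x+y | t₁ , _ , 1≡t₁x+y = t₁ - t₀ , (begin
    x * (t₁ - t₀)                  ≡⟨ solve 4 (λ x t₁ t₀ y → x :* (t₁ :- t₀) := t₁ :* x :+ y :- (t₀ :* x :+ y)) refl x t₁ t₀ y ⟩
    t₁ * x + y - (t₀ * x + y)      ≡⟨ cong₂ _-_ 1≡t₁x+y 0≡t₀x+y ⟨
    0# + 1# - 0#                   ≡⟨ solve 0 (:0 :+ :1 :- :0 := :1) refl ⟩
    1#                             ∎)

  module _ {x y} (invariant : SameSet (InAffineT e k x y) (InT e k)) where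

    private
      image∈T : ∀ i → InT e k (Gᶠ i * x + y)
      image∈T i = Equivalence.to (invariant (Gᶠ i * x + y)) (Gᶠ i , Gᶠ∈T i , refl)

      image : Fin k → Fin k
      image i = index (image∈T i)

      image-spec : ∀ i → Gᶠ (image i) ≡ Gᶠ i * x + y
      image-spec i = index-spec (image∈T i)

      preimage∈T : ∀ j → InAffineT e k x y (Gᶠ j)
      preimage∈T j = Equivalence.from (invariant (Gᶠ j)) (Gᶠ∈T j)

      preimage : Fin k → Fin k
      preimage j = index (proj₁ (proj₂ (preimage∈T j)))

      preimage-spec : ∀ j → Gᶠ j ≡ Gᶠ (preimage j) * x + y
      preimage-spec j = trans (proj₂ (proj₂ (preimage∈T j)))
        (cong (λ s → s * x + y) (sym (index-spec (proj₁ (proj₂ (preimage∈T j))))))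

      image-preimage : ∀ j → image (preimage j) ≡ j
      image-preimage j = Gᶠ-injective (trans (image-spec (preimage j)) (sym (preimage-spec j)))

      preimage-image : ∀ i → preimage (image i) ≡ i
      preimage-image i = Gᶠ-injective (isUnit-*-cancelʳ x (affine-invariant⇒isUnit invariant)
        (∙-cancelʳ y _ _ (trans (sym (preimage-spec (image i))) (image-spec i))))

    ∑T-affine : sum Gᶠ ≡ sum Gᶠ * x + [ k ] * y
    ∑T-affine = begin
      sum Gᶠ                           ≡⟨ sum-permute Gᶠ (permutation image preimage image-preimage preimage-image) ⟩
      sum (λ i → Gᶠ (image i))         ≡⟨ sum-cong-≗ image-spec ⟩
      sum (λ i → Gᶠ i * x + y)         ≡⟨ ∑-affine Gᶠ x y ⟩
      sum Gᶠ * x + [ k ] * y           ∎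

    k*y≡∑T-∑T*x : [ k ] * y ≡ sum Gᶠ - sum Gᶠ * x
    k*y≡∑T-∑T*x = begin
      [ k ] * y                                  ≡⟨ solve 3 (λ K y Sx → K :* y := Sx :+ K :* y :- Sx) refl [ k ] y (sum Gᶠ * x) ⟩
      sum Gᶠ * x + [ k ] * y - sum Gᶠ * x        ≡⟨ cong (_- sum Gᶠ * x) ∑T-affine ⟨
      sum Gᶠ - sum Gᶠ * x                        ∎

  affine-invariant⇒y≡u[x-1] : ∀ {x y} → SameSet (InAffineT e k x y) (InT e k) → y ≡ u * (x - 1#)
  affine-invariant⇒y≡u[x-1] {x} {y} invariant = isUnit-*-cancelˡ [ k ] (∤⇒isUnit p∤k) (begin
    [ k ] * y                               ≡⟨ k*y≡∑T-∑T*x invariant ⟩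
    S - S * x                               ≡⟨ solve 2 (λ S x → S :- S :* x := :- (S :* :1 :* (x :- :1))) refl S x ⟩
    - (S * 1# * (x - 1#))                   ≡⟨ cong (λ w → - (S * w * (x - 1#))) [e-1]u≡1 ⟨
    - (S * ((e - 1#) * u) * (x - 1#))       ≡⟨ solve 4 (λ S e u x → :- (S :* ((e :- :1) :* u) :* (x :- :1)) := (S :- S :* e) :* (u :* (x :- :1))) refl S e u x ⟩
    (S - S * e) * (u * (x - 1#))            ≡⟨ cong (_* (u * (x - 1#))) k≡S-Se ⟨
    [ k ] * (u * (x - 1#))                  ∎)
    where
    S = sum Gᶠ
    k≡S-Se : [ k ] ≡ S - S * e
    k≡S-Se = begin
      [ k ]                      ≡⟨ solve 1 (λ K → K := K :* (:0 :+ :1)) refl [ k ] ⟩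
      [ k ] * (0# + 1#)          ≡⟨ k*y≡∑T-∑T*x (rotation-invariant 1 2≤k) ⟩
      S - S * (e * 1#)           ≡⟨ cong (λ f → S - S * f) (*-identityʳ e) ⟩
      S - S * e                  ∎

  affine-invariant⇒ : ∀ {x y} → SameSet (InAffineT e k x y) (InT e k) →
                      ∃ λ l → l < k × x ≡ e ^ l × y ≡ geomSum e l
  affine-invariant⇒ {x} {y} invariant = l , l<k , x≡eˡ , y≡Gₗ
    where
    y∈T : InT e k y
    y∈T = Equivalence.to (invariant y) (0# , (0 , 0<k , refl) , sym (trans (cong (_+ y) (zeroˡ x)) (+-identityˡ y)))
    l : ℕ
    l = proj₁ y∈T
    l<k : l < k
    l<k = proj₁ (proj₂ y∈T)
    y≡Gₗ : y ≡ geomSum e l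
    y≡Gₗ = proj₂ (proj₂ y∈T)
    x≡eˡ : x ≡ e ^ l
    x≡eˡ = -1#-injective (isUnit-*-cancelˡ u u-isUnit
      (trans (sym (affine-invariant⇒y≡u[x-1] invariant)) (trans y≡Gₗ (G≡u[eⁱ-1] l))))

  affine-invariant⇔ : ∀ x y → SameSet (InAffineT e k x y) (InT e k) ⇔
    (∃ λ l → l < k × x ≡ e ^ l × (∀ u′ → (e - 1#) * u′ ≡ 1# → y ≡ u′ * (e ^ l - 1#)))
  affine-invariant⇔ x y = mk⇔ to from
    where
    to : SameSet (InAffineT e k x y) (InT e k) →
         ∃ λ l → l < k × x ≡ e ^ l × (∀ u′ → (e - 1#) * u′ ≡ 1# → y ≡ u′ * (e ^ l - 1#))
    to invariant =
      let l , l<k , x≡eˡ , y≡Gₗ = affine-invariant⇒ invariant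
      in  l , l<k , x≡eˡ , λ u′ [e-1]u′≡1 → trans y≡Gₗ (geomSum≡u*[fⁿ-1] [e-1]u′≡1 l)
    from : (∃ λ l → l < k × x ≡ e ^ l × (∀ u′ → (e - 1#) * u′ ≡ 1# → y ≡ u′ * (e ^ l - 1#))) →
           SameSet (InAffineT e k x y) (InT e k)
    from (l , l<k , x≡eˡ , y≡u′[eˡ-1]) =
      subst₂ (λ x′ y′ → SameSet (InAffineT e k x′ y′) (InT e k))
        (sym x≡eˡ) (trans (G≡u[eⁱ-1] l) (sym (y≡u′[eˡ-1] u [e-1]u≡1))) (rotation-invariant l l<k)

  linear-invariant⇔x≡1 : ∀ x → SameSet (InAffineT e k x 0#) (InT e k) ⇔ x ≡ 1#
  linear-invariant⇔x≡1 x = mk⇔ to from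
    where
    to : SameSet (InAffineT e k x 0#) (InT e k) → x ≡ 1#
    to invariant = x∙y⁻¹≈ε⇒x≈y x 1# (isUnit-*-cancelˡ u u-isUnit
      (trans (sym (affine-invariant⇒y≡u[x-1] invariant)) (sym (zeroʳ u))))
    from : x ≡ 1# → SameSet (InAffineT e k x 0#) (InT e k)
    from x≡1 = subst (λ x′ → SameSet (InAffineT e k x′ 0#) (InT e k)) (sym x≡1) (rotation-invariant 0 0<k)

  T≡u[eⁱ-1] : ∀ u′ → (e - 1#) * u′ ≡ 1# → ∀ z → InT e k z ⇔ (∃ λ i → i < k × z ≡ u′ * (e ^ i - 1#))
  T≡u[eⁱ-1] u′ [e-1]u′≡1 z = mk⇔
    (λ { (i , i<k , z≡Gᵢ) → i , i<k , trans z≡Gᵢ (geomSum≡u*[fⁿ-1] [e-1]u′≡1 i) })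
    (λ { (i , i<k , z≡u′[eⁱ-1]) → i , i<k , trans z≡u′[eⁱ-1] (sym (geomSum≡u*[fⁿ-1] [e-1]u′≡1 i)) })

  geomSum-e-k≡0 : geomSum e k ≡ 0#
  geomSum-e-k≡0 = geomSum-root-of-unity {k = k} e-1-isUnit eᵏ≡1

mainTheorem5 : (p α k : ℕ) (pp : Prime p) → 1 ≤ α → 2 ≤ k → k ∣ (p ∸ 1) →
  let open ZMod (p ^ℕ α) (primePow-nonZero pp α) in
  (e : ℤₙ) → IsUnit e → HasOrder e k →
    (∀ i → 1 ≤ i → i < k → IsUnit (e ^ i - 1#))
  × (geomSum e k ≡ 0#)
  × (∀ u → (e - 1#) * u ≡ 1# → ∀ z → InT e k z ⇔ (∃ λ i → i < k × z ≡ u * (e ^ i - 1#)))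
  × (∀ x y → SameSet (InAffineT e k x y) (InT e k) ⇔
       (∃ λ l → l < k × x ≡ e ^ l × (∀ u → (e - 1#) * u ≡ 1# → y ≡ u * (e ^ l - 1#))))
  × (∀ x → SameSet (InAffineT e k x 0#) (InT e k) ⇔ x ≡ 1#)
mainTheorem5 p α k pp 1≤α 2≤k k∣p-1 e e-unit e-order =
  eⁱ-1-isUnit , geomSum-e-k≡0 , T≡u[eⁱ-1] , affine-invariant⇔ , linear-invariant⇔x≡1
  where open OrderK p α k pp 1≤α 2≤k k∣p-1 e e-unit e-order
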